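{- For all raw terms $T,U$ and all $i\in\mathbb N$: (1) $T\le\mathsf{Prop}$ iff $\mathsf{Prop}\le T$ iff $T=_{\beta\varepsilon}\mathsf{Prop}$ iff $T\rhd_{\beta\varepsilon}^*\mathsf{Prop}$; (2) $T\le\mathsf{Type}(i)$ iff $T\rhd_{\beta\varepsilon}^*\mathsf{Type}(j)$ for some $j\le i$; (3) $\mathsf{Type}(i)\le T$ iff $T\rhd_{\beta\varepsilon}^*\mathsf{Type}(j)$ for some $j\ge i$; (4) if $T\le U$ and $U\le T$ then $U=_{\beta\varepsilon}T$.
   Context: Sorts are $\mathsf{Prop}$ and $\mathsf{Type}(i)$ for $i\in\mathbb N$. Tags are $*$ and $\diamond$; every variable carries a tag. Raw terms are generated by $t ::= s \mid x_{\mathsf s} \mid \lambda x_{\mathsf s}:t.\,t \mid (t\;t) \mid \Pi x_{\mathsf s}:t.\,t \mid \Sigma^{\mathsf s} x_{\mathsf s}:t.\,t \mid \langle t,t\rangle_{\Sigma^{\mathsf s}x_{\mathsf s}:t.\,t} \mid \pi_1(t) \mid \pi_2^{\mathsf s}(t) \mid \varepsilon$ ($s$ a sort, $\mathsf s$ a tag, $\varepsilon$ a constant), up to $\alpha$-conversion; contextual closure means rewriting at any subterm. Extraction $\rhd_\varepsilon$ is the contextual closure of $x_*\rhd_\varepsilon\varepsilon$, $\lambda x:A.\varepsilon\rhd_\varepsilon\varepsilon$, $(\varepsilon\;t)\rhd_\varepsilon\varepsilon$, $\pi_2^*(t)\rhd_\varepsilon\varepsilon$. The tag $s(t)$ is $*$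 if $t\rhd_\varepsilon^*\varepsilon$ and $\diamond$ otherwise. $\rhd_\beta$ is the contextual closure of $((\lambda x_{\mathsf s}:A.t)\;u)\rhd_\beta t[x_{\mathsf s}\setminus u]$ if $s(u)=\mathsf s$; $\pi_1(\langle a,b\rangle_{\Sigma^{\mathsf s'}x:A.B})\rhd_\beta a$ if $s(a)=\diamond$; $\pi_2^{\mathsf s}(\langle a,b\rangle_{\Sigma^{\mathsf s'}x:A.B})\rhd_\beta b$ if $s(b)=\mathsf s$. $\rhd_{\beta\varepsilon}=\rhd_\beta\cup\rhd_\varepsilon$, $\rhd_{\beta\varepsilon}^*$ is its reflexive-transitive closure and $=_{\beta\varepsilon}$ its reflexive-symmetric-transitive closure. Subtyping $\le$ is the smallest transitive relation on raw terms such that $\mathsf{Type}(i)\le\mathsf{Type}(i+1)$ for all $i$, $T=_{\beta\varepsilon}T'$ implies $T\le T'$, and $B\le B'$ implies $\Pi x:A.B\le\Pi x:A.B'$. -}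

module Defs where

open import Data.Nat using (ℕ; zero; suc; pred; _<ᵇ_; _≡ᵇ_)
open import Data.Bool using (Bool; true; false; if_then_else_)
open import Data.Empty using (⊥)
open import Relation.Nullary using (¬_)
open import Relation.Binary.PropositionalEquality using (_≡_)
open import Relation.Binary.Construct.Closure.ReflexiveTransitive using (Star)
open import Relation.Binary.Construct.Closure.Equivalence using (EqClosure)

data Sort : Set where
  Prop : Sort
  Type : ℕ → Sort

data Tag : Set where
  ⋆ : Tag
  ◇ : Tag

sameTag : Tag → Tag → Bool
sameTag ⋆ ⋆ = true
sameTag ◇ ◇ = true
sameTag _ _ = false

-- Raw terms, up to α-conversion: locally nameless via de Bruijn indices.
-- Since variables x_* and x_⋄ live in separate name spaces, a variable
-- is  var s n  where n counts only the enclosing binders of tag s.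

data Term : Set where
  sort : Sort → Term
  var  : Tag → ℕ → Term
  -- λ x_s : A . t          ~  lam s A t      (t under the binder)
  lam  : Tag → Term → Term → Term
  app  : Term → Term → Term
  -- Π x_s : A . B          ~  pi s A B       (B under the binder)
  pi   : Tag → Term → Term → Term
  -- Σ^{s'} x_s : A . B     ~  sig s' s A B   (B under the binder)
  sig  : Tag → Tag → Term → Term → Term
  -- ⟨a , b⟩_{Σ^{s'} x_s : A . B}  ~  pair s' s A B a b  (only B under the binder)
  pair : Tag → Tag → Term → Term → Term → Term → Term
  π₁   : Term → Term
  π₂   : Tag → Term → Term
  ε    : Term

-- cutoff / index update when going under a binder of tag b,
-- for operations concerning variables of tag s
up : Tag → Tag → ℕ → ℕ
up b s c = if sameTag b s then suc c else c

shift : Tag → ℕ → Term → Term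
shift s c (sort k) = sort k
shift s c (var s' n) =
  if sameTag s s' then (if n <ᵇ c then var s' n else var s' (suc n)) else var s' n
shift s c (lam b A t) = lam b (shift s c A) (shift s (up b s c) t)
shift s c (app t u) = app (shift s c t) (shift s c u)
shift s c (pi b A B) = pi b (shift s c A) (shift s (up b s c) B)
shift s c (sig s' b A B) = sig s' b (shift s c A) (shift s (up b s c) B)
shift s c (pair s' b A B a b') =
  pair s' b (shift s c A) (shift s (up b s c) B) (shift s c a) (shift s c b')
shift s c (π₁ t) = π₁ (shift s c t)
shift s c (π₂ s' t) = π₂ s' (shift s c t)
shift s c ε = ε

-- subst s j u t : t with tag-s variable j replaced by u (and the
-- tag-s variables above j decremented, as the binder disappears)
subst : Tag → ℕ → Term → Term → Term
subst s j u (sort k) = sort k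
subst s j u (var s' n) =
  if sameTag s s'
  then (if n ≡ᵇ j then u else (if j <ᵇ n then var s' (pred n) else var s' n))
  else var s' n
subst s j u (lam b A t) = lam b (subst s j u A) (subst s (up b s j) (shift b 0 u) t)
subst s j u (app t v) = app (subst s j u t) (subst s j u v)
subst s j u (pi b A B) = pi b (subst s j u A) (subst s (up b s j) (shift b 0 u) B)
subst s j u (sig s' b A B) = sig s' b (subst s j u A) (subst s (up b s j) (shift b 0 u) B)
subst s j u (pair s' b A B a b') =
  pair s' b (subst s j u A) (subst s (up b s j) (shift b 0 u) B)
       (subst s j u a) (subst s j u b')
subst s j u (π₁ t) = π₁ (subst s j u t)
subst s j u (π₂ s' t) = π₂ s' (subst s j u t)
subst s j u ε = ε

-- t [x_s ∖ u] for the variable bound by the outermost removed binder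
_[_∖_] : Term → Tag → Term → Term
t [ s ∖ u ] = subst s 0 u t

Rel : Set₁
Rel = Term → Term → Set

data Ctx (R : Rel) : Rel where
  base   : ∀ {t t'} → R t t' → Ctx R t t'
  lamA   : ∀ {s A A' t} → Ctx R A A' → Ctx R (lam s A t) (lam s A' t)
  lamT   : ∀ {s A t t'} → Ctx R t t' → Ctx R (lam s A t) (lam s A t')
  appL   : ∀ {t t' u} → Ctx R t t' → Ctx R (app t u) (app t' u)
  appR   : ∀ {t u u'} → Ctx R u u' → Ctx R (app t u) (app t u')
  piA    : ∀ {s A A' B} → Ctx R A A' → Ctx R (pi s A B) (pi s A' B)
  piB    : ∀ {s A B B'} → Ctx R B B' → Ctx R (pi s A B) (pi s A B')
  sigA   : ∀ {s' s A A' B} → Ctx R A A' → Ctx R (sig s' s A B) (sig s' s A' B)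
  sigB   : ∀ {s' s A B B'} → Ctx R B B' → Ctx R (sig s' s A B) (sig s' s A B')
  pairA  : ∀ {s' s A A' B a b} → Ctx R A A' →
           Ctx R (pair s' s A B a b) (pair s' s A' B a b)
  pairB  : ∀ {s' s A B B' a b} → Ctx R B B' →
           Ctx R (pair s' s A B a b) (pair s' s A B' a b)
  paira  : ∀ {s' s A B a a' b} → Ctx R a a' →
           Ctx R (pair s' s A B a b) (pair s' s A B a' b)
  pairb  : ∀ {s' s A B a b b'} → Ctx R b b' →
           Ctx R (pair s' s A B a b) (pair s' s A B a b')
  π₁c    : ∀ {t t'} → Ctx R t t' → Ctx R (π₁ t) (π₁ t')
  π₂c    : ∀ {s t t'} → Ctx R t t' → Ctx R (π₂ s t) (π₂ s t')

data ε-base : Rel where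
  ε-var : ∀ {n} → ε-base (var ⋆ n) ε
  ε-lam : ∀ {s A} → ε-base (lam s A ε) ε
  ε-app : ∀ {t} → ε-base (app ε t) ε
  ε-π₂  : ∀ {t} → ε-base (π₂ ⋆ t) ε

_▷ε_ : Rel
_▷ε_ = Ctx ε-base

_▷ε*_ : Rel
_▷ε*_ = Star _▷ε_

-- the tag s(t): TagOf t s  means  s(t) = s
data TagOf (t : Term) : Tag → Set where
  tag⋆ : t ▷ε* ε → TagOf t ⋆
  tag◇ : ¬ (t ▷ε* ε) → TagOf t ◇

data β-base : Rel where
  β-app : ∀ {s A t u} → TagOf u s → β-base (app (lam s A t) u) (t [ s ∖ u ])
  β-π₁  : ∀ {s' s A B a b} → TagOf a ◇ → β-base (π₁ (pair s' s A B a b)) a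
  β-π₂  : ∀ {s'' s' s A B a b} → TagOf b s'' →
          β-base (π₂ s'' (pair s' s A B a b)) b

_▷β_ : Rel
_▷β_ = Ctx β-base

data _▷βε_ : Rel where
  byβ : ∀ {t t'} → t ▷β t' → t ▷βε t'
  byε : ∀ {t t'} → t ▷ε t' → t ▷βε t'

_▷βε*_ : Rel
_▷βε*_ = Star _▷βε_

_=βε_ : Rel
_=βε_ = EqClosure _▷βε_

data _≼_ : Rel where
  ≼-trans : ∀ {T U V} → T ≼ U → U ≼ V → T ≼ V
  ≼-type  : ∀ i → sort (Type i) ≼ sort (Type (suc i))
  ≼-conv  : ∀ {T T'} → T =βε T' → T ≼ T'
  ≼-pi    : ∀ {s A B B'} → B ≼ B' → pi s A B ≼ pi s A B'

-- Everything rests on the Church–Rosser property of ▷βε, proved in the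
-- style of Tait–Martin-Löf and Takahashi: a parallel reduction ⇒ lies
-- between ▷βε and ▷βε*, and every parallel reduct of t reduces in parallel
-- to the complete development dev t (the triangle property).  The side
-- condition s(u) = s on β-redexes is handled through a syntactic test ε?
-- with ε? u ≡ true iff u ▷ε* ε; it is invariant under substitution and
-- parallel reduction.  The substitution lemmas use a small algebra of
-- tag-indexed renamings and substitutions, of which shift and subst of
-- Defs are instances.
--
-- With confluence, joinability ↓ is an equivalence coinciding with =βε,
-- sorts are normal forms and Π-types are injective.  We then introduce a
-- syntax-directed subtyping ⊑ (joinable, or reducing to sorts in
-- cumulativity order, or to Π-types with joinable domains and ⊑-related
-- codomains), prove it transitive, hence containing ≼, and antisymmetric
-- up to ↓.  The corollary is read off from ⊑ on sorts and antisymmetry.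
module Submission where

open import Data.Bool using (Bool; true; false; if_then_else_)
open import Data.Bool.Properties using () renaming (_≟_ to _≟ᵇ_)
open import Data.Nat
  using (ℕ; zero; suc; pred; _≤_; _≥_; _<ᵇ_; _≡ᵇ_; _≤′_; ≤′-refl; ≤′-step)
open import Data.Nat.Properties using (≤-refl; ≤-trans; ≤-antisym; n≤1+n; ≤⇒≤′)
open import Data.Product using (_×_; ∃-syntax; _,_)
open import Function.Base using (_∘_)
open import Function.Bundles using (_⇔_; mk⇔)
open import Relation.Nullary using (¬_; yes; no; does; contradiction)
open import Relation.Binary.PropositionalEquality
  using (_≡_; refl; sym; trans; cong; cong₂; subst₂; module ≡-Reasoning)
import Relation.Binary.PropositionalEquality as Eq
open import Relation.Binary.Construct.Closure.ReflexiveTransitive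
  using (Star; _◅_; _◅◅_; gmap; map) renaming (ε to [])
open import Relation.Binary.Construct.Closure.Symmetric using (fwd; bwd)
open import Relation.Binary.Construct.Closure.Equivalence using (symmetric)
open import Relation.Binary.Construct.Closure.Equivalence.Properties
  using (a—↠b⇒a↔b; a—↠b⇒b↔a)
open import Relation.Binary.Rewriting using (Confluent)

open import Defs

infix 4 _≐_
_≐_ : {A : Set} → (Tag → ℕ → A) → (Tag → ℕ → A) → Set
f ≐ g = ∀ s n → f s n ≡ g s n

Ren : Set
Ren = Tag → ℕ → ℕ

Sub : Set
Sub = Tag → ℕ → Term

ext : (ℕ → ℕ) → ℕ → ℕ
ext f zero = zero
ext f (suc n) = suc (f n)

-- lifting a renaming under a binder of tag b; up b is the weakening past it
liftRen : Tag → Ren → Ren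
liftRen b ρ s = if sameTag b s then ext (ρ s) else ρ s

ren : Ren → Term → Term
ren ρ (sort k) = sort k
ren ρ (var s n) = var s (ρ s n)
ren ρ (lam b A t) = lam b (ren ρ A) (ren (liftRen b ρ) t)
ren ρ (app t u) = app (ren ρ t) (ren ρ u)
ren ρ (pi b A B) = pi b (ren ρ A) (ren (liftRen b ρ) B)
ren ρ (sig s' b A B) = sig s' b (ren ρ A) (ren (liftRen b ρ) B)
ren ρ (pair s' b A B a c) = pair s' b (ren ρ A) (ren (liftRen b ρ) B) (ren ρ a) (ren ρ c)
ren ρ (π₁ t) = π₁ (ren ρ t)
ren ρ (π₂ s t) = π₂ s (ren ρ t)
ren ρ ε = ε

extSub : Tag → (ℕ → Term) → ℕ → Term
extSub s f zero = var s zero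
extSub s f (suc n) = f n

liftSub : Tag → Sub → Sub
liftSub b σ s =
  if sameTag b s then extSub s (λ n → ren (up b) (σ s n)) else (λ n → ren (up b) (σ s n))

sub : Sub → Term → Term
sub σ (sort k) = sort k
sub σ (var s n) = σ s n
sub σ (lam b A t) = lam b (sub σ A) (sub (liftSub b σ) t)
sub σ (app t u) = app (sub σ t) (sub σ u)
sub σ (pi b A B) = pi b (sub σ A) (sub (liftSub b σ) B)
sub σ (sig s' b A B) = sig s' b (sub σ A) (sub (liftSub b σ) B)
sub σ (pair s' b A B a c) = pair s' b (sub σ A) (sub (liftSub b σ) B) (sub σ a) (sub σ c)
sub σ (π₁ t) = π₁ (sub σ t)
sub σ (π₂ s t) = π₂ s (sub σ t)
sub σ ε = ε

cong-pair : ∀ {s' b A A' B B' a a' c c'} → A ≡ A' → B ≡ B' → a ≡ a' → c ≡ c' →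
            pair s' b A B a c ≡ pair s' b A' B' a' c'
cong-pair refl refl refl refl = refl

ext-cong : ∀ {f g : ℕ → ℕ} → (∀ n → f n ≡ g n) → ∀ n → ext f n ≡ ext g n
ext-cong h zero = refl
ext-cong h (suc n) = cong suc (h n)

liftRen-cong : ∀ {ρ ρ'} → ρ ≐ ρ' → ∀ b → liftRen b ρ ≐ liftRen b ρ'
liftRen-cong h b s n with sameTag b s
... | true = ext-cong (h s) n
... | false = h s n

ren-cong : ∀ {ρ ρ'} → ρ ≐ ρ' → ∀ t → ren ρ t ≡ ren ρ' t
ren-cong h (sort k) = refl
ren-cong h (var s n) = cong (var s) (h s n)
ren-cong h (lam b A t) = cong₂ (lam b) (ren-cong h A) (ren-cong (liftRen-cong h b) t)
ren-cong h (app t u) = cong₂ app (ren-cong h t) (ren-cong h u)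
ren-cong h (pi b A B) = cong₂ (pi b) (ren-cong h A) (ren-cong (liftRen-cong h b) B)
ren-cong h (sig s' b A B) = cong₂ (sig s' b) (ren-cong h A) (ren-cong (liftRen-cong h b) B)
ren-cong h (pair s' b A B a c) =
  cong-pair (ren-cong h A) (ren-cong (liftRen-cong h b) B) (ren-cong h a) (ren-cong h c)
ren-cong h (π₁ t) = cong π₁ (ren-cong h t)
ren-cong h (π₂ s t) = cong (π₂ s) (ren-cong h t)
ren-cong h ε = refl

liftSub-cong : ∀ {σ σ'} → σ ≐ σ' → ∀ b → liftSub b σ ≐ liftSub b σ'
liftSub-cong h b s n with sameTag b s
liftSub-cong h b s zero    | true = refl
liftSub-cong h b s (suc n) | true = cong (ren (up b)) (h s n)
... | false = cong (ren (up b)) (h s n)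

sub-cong : ∀ {σ σ'} → σ ≐ σ' → ∀ t → sub σ t ≡ sub σ' t
sub-cong h (sort k) = refl
sub-cong h (var s n) = h s n
sub-cong h (lam b A t) = cong₂ (lam b) (sub-cong h A) (sub-cong (liftSub-cong h b) t)
sub-cong h (app t u) = cong₂ app (sub-cong h t) (sub-cong h u)
sub-cong h (pi b A B) = cong₂ (pi b) (sub-cong h A) (sub-cong (liftSub-cong h b) B)
sub-cong h (sig s' b A B) = cong₂ (sig s' b) (sub-cong h A) (sub-cong (liftSub-cong h b) B)
sub-cong h (pair s' b A B a c) =
  cong-pair (sub-cong h A) (sub-cong (liftSub-cong h b) B) (sub-cong h a) (sub-cong h c)
sub-cong h (π₁ t) = cong π₁ (sub-cong h t)
sub-cong h (π₂ s t) = cong (π₂ s) (sub-cong h t)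
sub-cong h ε = refl

infixr 9 _∘ʳ_ _ˢ∘ʳ_ _ʳ∘ˢ_ _∘ˢ_

_∘ʳ_ : Ren → Ren → Ren
(ρ ∘ʳ ρ') s n = ρ s (ρ' s n)

_ˢ∘ʳ_ : Sub → Ren → Sub
(σ ˢ∘ʳ ρ) s n = σ s (ρ s n)

_ʳ∘ˢ_ : Ren → Sub → Sub
(ρ ʳ∘ˢ σ) s n = ren ρ (σ s n)

_∘ˢ_ : Sub → Sub → Sub
(σ ∘ˢ τ) s n = sub σ (τ s n)

liftRen-∘ : ∀ ρ ρ' b → liftRen b ρ ∘ʳ liftRen b ρ' ≐ liftRen b (ρ ∘ʳ ρ')
liftRen-∘ ρ ρ' b s n with sameTag b s
liftRen-∘ ρ ρ' b s zero    | true = refl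
liftRen-∘ ρ ρ' b s (suc n) | true = refl
... | false = refl

ren-ren : ∀ ρ ρ' t → ren ρ (ren ρ' t) ≡ ren (ρ ∘ʳ ρ') t
ren-ren ρ ρ' (sort k) = refl
ren-ren ρ ρ' (var s n) = refl
ren-ren ρ ρ' (lam b A t) =
  cong₂ (lam b) (ren-ren ρ ρ' A) (trans (ren-ren _ _ t) (ren-cong (liftRen-∘ ρ ρ' b) t))
ren-ren ρ ρ' (app t u) = cong₂ app (ren-ren ρ ρ' t) (ren-ren ρ ρ' u)
ren-ren ρ ρ' (pi b A B) =
  cong₂ (pi b) (ren-ren ρ ρ' A) (trans (ren-ren _ _ B) (ren-cong (liftRen-∘ ρ ρ' b) B))
ren-ren ρ ρ' (sig s' b A B) =
  cong₂ (sig s' b) (ren-ren ρ ρ' A) (trans (ren-ren _ _ B) (ren-cong (liftRen-∘ ρ ρ' b) B))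
ren-ren ρ ρ' (pair s' b A B a c) =
  cong-pair (ren-ren ρ ρ' A) (trans (ren-ren _ _ B) (ren-cong (liftRen-∘ ρ ρ' b) B))
            (ren-ren ρ ρ' a) (ren-ren ρ ρ' c)
ren-ren ρ ρ' (π₁ t) = cong π₁ (ren-ren ρ ρ' t)
ren-ren ρ ρ' (π₂ s t) = cong (π₂ s) (ren-ren ρ ρ' t)
ren-ren ρ ρ' ε = refl

liftSub-∘ʳ : ∀ σ ρ b → liftSub b σ ˢ∘ʳ liftRen b ρ ≐ liftSub b (σ ˢ∘ʳ ρ)
liftSub-∘ʳ σ ρ b s n with sameTag b s
liftSub-∘ʳ σ ρ b s zero    | true = refl
liftSub-∘ʳ σ ρ b s (suc n) | true = refl
... | false = refl

sub-ren : ∀ σ ρ t → sub σ (ren ρ t) ≡ sub (σ ˢ∘ʳ ρ) t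
sub-ren σ ρ (sort k) = refl
sub-ren σ ρ (var s n) = refl
sub-ren σ ρ (lam b A t) =
  cong₂ (lam b) (sub-ren σ ρ A) (trans (sub-ren _ _ t) (sub-cong (liftSub-∘ʳ σ ρ b) t))
sub-ren σ ρ (app t u) = cong₂ app (sub-ren σ ρ t) (sub-ren σ ρ u)
sub-ren σ ρ (pi b A B) =
  cong₂ (pi b) (sub-ren σ ρ A) (trans (sub-ren _ _ B) (sub-cong (liftSub-∘ʳ σ ρ b) B))
sub-ren σ ρ (sig s' b A B) =
  cong₂ (sig s' b) (sub-ren σ ρ A) (trans (sub-ren _ _ B) (sub-cong (liftSub-∘ʳ σ ρ b) B))
sub-ren σ ρ (pair s' b A B a c) =
  cong-pair (sub-ren σ ρ A) (trans (sub-ren _ _ B) (sub-cong (liftSub-∘ʳ σ ρ b) B))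
            (sub-ren σ ρ a) (sub-ren σ ρ c)
sub-ren σ ρ (π₁ t) = cong π₁ (sub-ren σ ρ t)
sub-ren σ ρ (π₂ s t) = cong (π₂ s) (sub-ren σ ρ t)
sub-ren σ ρ ε = refl

ren-weaken : ∀ ρ b t → ren (liftRen b ρ) (ren (up b) t) ≡ ren (up b) (ren ρ t)
ren-weaken ρ b t = begin
  ren (liftRen b ρ) (ren (up b) t) ≡⟨ ren-ren _ _ t ⟩
  ren (liftRen b ρ ∘ʳ up b) t      ≡⟨ ren-cong commute t ⟩
  ren (up b ∘ʳ ρ) t                ≡⟨ ren-ren _ _ t ⟨
  ren (up b) (ren ρ t)             ∎
  where
  open ≡-Reasoning
  commute : liftRen b ρ ∘ʳ up b ≐ up b ∘ʳ ρ
  commute s n with sameTag b s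
  ... | true = refl
  ... | false = refl

liftRen-bound : ∀ b ρ s → sameTag b s ≡ true → liftRen b ρ s zero ≡ zero
liftRen-bound b ρ s same rewrite same = refl

liftRen-∘ˢ : ∀ ρ σ b → liftRen b ρ ʳ∘ˢ liftSub b σ ≐ liftSub b (ρ ʳ∘ˢ σ)
liftRen-∘ˢ ρ σ b s n with sameTag b s in same
liftRen-∘ˢ ρ σ b s zero    | true = cong (var s) (liftRen-bound b ρ s same)
liftRen-∘ˢ ρ σ b s (suc n) | true = ren-weaken ρ b (σ s n)
... | false = ren-weaken ρ b (σ s n)

ren-sub : ∀ ρ σ t → ren ρ (sub σ t) ≡ sub (ρ ʳ∘ˢ σ) t
ren-sub ρ σ (sort k) = refl
ren-sub ρ σ (var s n) = refl
ren-sub ρ σ (lam b A t) =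
  cong₂ (lam b) (ren-sub ρ σ A) (trans (ren-sub _ _ t) (sub-cong (liftRen-∘ˢ ρ σ b) t))
ren-sub ρ σ (app t u) = cong₂ app (ren-sub ρ σ t) (ren-sub ρ σ u)
ren-sub ρ σ (pi b A B) =
  cong₂ (pi b) (ren-sub ρ σ A) (trans (ren-sub _ _ B) (sub-cong (liftRen-∘ˢ ρ σ b) B))
ren-sub ρ σ (sig s' b A B) =
  cong₂ (sig s' b) (ren-sub ρ σ A) (trans (ren-sub _ _ B) (sub-cong (liftRen-∘ˢ ρ σ b) B))
ren-sub ρ σ (pair s' b A B a c) =
  cong-pair (ren-sub ρ σ A) (trans (ren-sub _ _ B) (sub-cong (liftRen-∘ˢ ρ σ b) B))
            (ren-sub ρ σ a) (ren-sub ρ σ c)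
ren-sub ρ σ (π₁ t) = cong π₁ (ren-sub ρ σ t)
ren-sub ρ σ (π₂ s t) = cong (π₂ s) (ren-sub ρ σ t)
ren-sub ρ σ ε = refl

sub-weaken : ∀ σ b t → sub (liftSub b σ) (ren (up b) t) ≡ ren (up b) (sub σ t)
sub-weaken σ b t = begin
  sub (liftSub b σ) (ren (up b) t) ≡⟨ sub-ren _ _ t ⟩
  sub (liftSub b σ ˢ∘ʳ up b) t     ≡⟨ sub-cong commute t ⟩
  sub (up b ʳ∘ˢ σ) t               ≡⟨ ren-sub _ _ t ⟨
  ren (up b) (sub σ t)             ∎
  where
  open ≡-Reasoning
  commute : liftSub b σ ˢ∘ʳ up b ≐ up b ʳ∘ˢ σ
  commute s n with sameTag b s
  ... | true = refl
  ... | false = refl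

liftSub-bound : ∀ b σ s → sameTag b s ≡ true → liftSub b σ s zero ≡ var s zero
liftSub-bound b σ s same rewrite same = refl

liftSub-∘ˢ : ∀ σ τ b → liftSub b σ ∘ˢ liftSub b τ ≐ liftSub b (σ ∘ˢ τ)
liftSub-∘ˢ σ τ b s n with sameTag b s in same
liftSub-∘ˢ σ τ b s zero    | true = liftSub-bound b σ s same
liftSub-∘ˢ σ τ b s (suc n) | true = sub-weaken σ b (τ s n)
... | false = sub-weaken σ b (τ s n)

sub-sub : ∀ σ τ t → sub σ (sub τ t) ≡ sub (σ ∘ˢ τ) t
sub-sub σ τ (sort k) = refl
sub-sub σ τ (var s n) = refl
sub-sub σ τ (lam b A t) =
  cong₂ (lam b) (sub-sub σ τ A) (trans (sub-sub _ _ t) (sub-cong (liftSub-∘ˢ σ τ b) t))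
sub-sub σ τ (app t u) = cong₂ app (sub-sub σ τ t) (sub-sub σ τ u)
sub-sub σ τ (pi b A B) =
  cong₂ (pi b) (sub-sub σ τ A) (trans (sub-sub _ _ B) (sub-cong (liftSub-∘ˢ σ τ b) B))
sub-sub σ τ (sig s' b A B) =
  cong₂ (sig s' b) (sub-sub σ τ A) (trans (sub-sub _ _ B) (sub-cong (liftSub-∘ˢ σ τ b) B))
sub-sub σ τ (pair s' b A B a c) =
  cong-pair (sub-sub σ τ A) (trans (sub-sub _ _ B) (sub-cong (liftSub-∘ˢ σ τ b) B))
            (sub-sub σ τ a) (sub-sub σ τ c)
sub-sub σ τ (π₁ t) = cong π₁ (sub-sub σ τ t)
sub-sub σ τ (π₂ s t) = cong (π₂ s) (sub-sub σ τ t)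
sub-sub σ τ ε = refl

idSub : Sub
idSub = var

liftSub-id : ∀ b → liftSub b idSub ≐ idSub
liftSub-id ⋆ ⋆ zero    = refl
liftSub-id ⋆ ⋆ (suc n) = refl
liftSub-id ⋆ ◇ n       = refl
liftSub-id ◇ ⋆ n       = refl
liftSub-id ◇ ◇ zero    = refl
liftSub-id ◇ ◇ (suc n) = refl

sub-id : ∀ t → sub idSub t ≡ t
sub-id (sort k) = refl
sub-id (var s n) = refl
sub-id (lam b A t) = cong₂ (lam b) (sub-id A) (trans (sub-cong (liftSub-id b) t) (sub-id t))
sub-id (app t u) = cong₂ app (sub-id t) (sub-id u)
sub-id (pi b A B) = cong₂ (pi b) (sub-id A) (trans (sub-cong (liftSub-id b) B) (sub-id B))
sub-id (sig s' b A B) = cong₂ (sig s' b) (sub-id A) (trans (sub-cong (liftSub-id b) B) (sub-id B))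
sub-id (pair s' b A B a c) =
  cong-pair (sub-id A) (trans (sub-cong (liftSub-id b) B) (sub-id B)) (sub-id a) (sub-id c)
sub-id (π₁ t) = cong π₁ (sub-id t)
sub-id (π₂ s t) = cong (π₂ s) (sub-id t)
sub-id ε = refl

shiftRen : Tag → ℕ → Ren
shiftRen s c s' n = if sameTag s s' then (if n <ᵇ c then n else suc n) else n

shift-var : ∀ s c s' n → shift s c (var s' n) ≡ var s' (shiftRen s c s' n)
shift-var ⋆ c ⋆ n with n <ᵇ c
... | true = refl
... | false = refl
shift-var ◇ c ◇ n with n <ᵇ c
... | true = refl
... | false = refl
shift-var ⋆ c ◇ n = refl
shift-var ◇ c ⋆ n = refl

shiftRen-lift : ∀ s c b → shiftRen s (up b s c) ≐ liftRen b (shiftRen s c)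
shiftRen-lift ⋆ c ⋆ ⋆ zero = refl
shiftRen-lift ⋆ c ⋆ ⋆ (suc m) with m <ᵇ c
... | true = refl
... | false = refl
shiftRen-lift ◇ c ◇ ◇ zero = refl
shiftRen-lift ◇ c ◇ ◇ (suc m) with m <ᵇ c
... | true = refl
... | false = refl
shiftRen-lift ⋆ c ◇ ◇ zero = refl
shiftRen-lift ⋆ c ◇ ◇ (suc n) = refl
shiftRen-lift ◇ c ⋆ ⋆ zero = refl
shiftRen-lift ◇ c ⋆ ⋆ (suc n) = refl
shiftRen-lift ⋆ c ⋆ ◇ n = refl
shiftRen-lift ⋆ c ◇ ⋆ n = refl
shiftRen-lift ◇ c ⋆ ◇ n = refl
shiftRen-lift ◇ c ◇ ⋆ n = refl

shift≡ren : ∀ s c t → shift s c t ≡ ren (shiftRen s c) t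
shift≡ren s c (sort k) = refl
shift≡ren s c (var s' n) = shift-var s c s' n
shift≡ren s c (lam b A t) =
  cong₂ (lam b) (shift≡ren s c A) (trans (shift≡ren s _ t) (ren-cong (shiftRen-lift s c b) t))
shift≡ren s c (app t u) = cong₂ app (shift≡ren s c t) (shift≡ren s c u)
shift≡ren s c (pi b A B) =
  cong₂ (pi b) (shift≡ren s c A) (trans (shift≡ren s _ B) (ren-cong (shiftRen-lift s c b) B))
shift≡ren s c (sig s' b A B) =
  cong₂ (sig s' b) (shift≡ren s c A)
        (trans (shift≡ren s _ B) (ren-cong (shiftRen-lift s c b) B))
shift≡ren s c (pair s' b A B a d) =
  cong-pair (shift≡ren s c A) (trans (shift≡ren s _ B) (ren-cong (shiftRen-lift s c b) B))
            (shift≡ren s c a) (shift≡ren s c d)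
shift≡ren s c (π₁ t) = cong π₁ (shift≡ren s c t)
shift≡ren s c (π₂ s' t) = cong (π₂ s') (shift≡ren s c t)
shift≡ren s c ε = refl

shift₀≡weaken : ∀ b u → shift b 0 u ≡ ren (up b) u
shift₀≡weaken b u = trans (shift≡ren b 0 u) (ren-cong shiftRen₀ u)
  where
  shiftRen₀ : shiftRen b 0 ≐ up b
  shiftRen₀ s n with sameTag b s
  ... | true = refl
  ... | false = refl

substVar : ℕ → Term → Tag → ℕ → Term
substVar j u s n = if n ≡ᵇ j then u else (if j <ᵇ n then var s (pred n) else var s n)

substSub : Tag → ℕ → Term → Sub
substSub s j u s' n = if sameTag s s' then substVar j u s' n else var s' n

up-self : ∀ s → sameTag s s ≡ true → ∀ n → up s s n ≡ suc n
up-self s same n rewrite same = refl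

up-other : ∀ b s → sameTag b s ≡ false → ∀ n → up b s n ≡ n
up-other b s other n rewrite other = refl

substVar-weaken : ∀ s j u m → sameTag s s ≡ true →
  substVar (suc j) (shift s 0 u) s (suc m) ≡ ren (up s) (substVar j u s m)
substVar-weaken s j u zero same with 0 ≡ᵇ j
... | true  = shift₀≡weaken s u
... | false = cong (var s) (sym (up-self s same 0))
substVar-weaken s j u (suc k) same with suc k ≡ᵇ j
... | true  = shift₀≡weaken s u
... | false with j <ᵇ suc k
...   | true  = cong (var s) (sym (up-self s same k))
...   | false = cong (var s) (sym (up-self s same (suc k)))

substVar-other : ∀ b j u s n → sameTag b s ≡ false →
  substVar j (shift b 0 u) s n ≡ ren (up b) (substVar j u s n)
substVar-other b j u s n other with n ≡ᵇ j
... | true = shift₀≡weaken b u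
... | false with j <ᵇ n
...   | true  = cong (var s) (sym (up-other b s other (pred n)))
...   | false = cong (var s) (sym (up-other b s other n))

substSub-lift : ∀ s j u b → substSub s (up b s j) (shift b 0 u) ≐ liftSub b (substSub s j u)
substSub-lift ⋆ j u ⋆ ⋆ zero    = refl
substSub-lift ⋆ j u ⋆ ⋆ (suc m) = substVar-weaken ⋆ j u m refl
substSub-lift ◇ j u ◇ ◇ zero    = refl
substSub-lift ◇ j u ◇ ◇ (suc m) = substVar-weaken ◇ j u m refl
substSub-lift ⋆ j u ◇ ⋆ n       = substVar-other ◇ j u ⋆ n refl
substSub-lift ◇ j u ⋆ ◇ n       = substVar-other ⋆ j u ◇ n refl
substSub-lift ⋆ j u ⋆ ◇ n       = refl
substSub-lift ◇ j u ◇ ⋆ n       = refl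
substSub-lift ⋆ j u ◇ ◇ zero    = refl
substSub-lift ⋆ j u ◇ ◇ (suc n) = refl
substSub-lift ◇ j u ⋆ ⋆ zero    = refl
substSub-lift ◇ j u ⋆ ⋆ (suc n) = refl

subst≡sub : ∀ s j u t → subst s j u t ≡ sub (substSub s j u) t
subst≡sub s j u (sort k) = refl
subst≡sub s j u (var s' n) = refl
subst≡sub s j u (lam b A t) =
  cong₂ (lam b) (subst≡sub s j u A)
        (trans (subst≡sub s _ _ t) (sub-cong (substSub-lift s j u b) t))
subst≡sub s j u (app t v) = cong₂ app (subst≡sub s j u t) (subst≡sub s j u v)
subst≡sub s j u (pi b A B) =
  cong₂ (pi b) (subst≡sub s j u A)
        (trans (subst≡sub s _ _ B) (sub-cong (substSub-lift s j u b) B))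
subst≡sub s j u (sig s' b A B) =
  cong₂ (sig s' b) (subst≡sub s j u A)
        (trans (subst≡sub s _ _ B) (sub-cong (substSub-lift s j u b) B))
subst≡sub s j u (pair s' b A B a d) =
  cong-pair (subst≡sub s j u A) (trans (subst≡sub s _ _ B) (sub-cong (substSub-lift s j u b) B))
            (subst≡sub s j u a) (subst≡sub s j u d)
subst≡sub s j u (π₁ t) = cong π₁ (subst≡sub s j u t)
subst≡sub s j u (π₂ s' t) = cong (π₂ s') (subst≡sub s j u t)
subst≡sub s j u ε = refl

single : Tag → Term → Sub
single s u = substSub s 0 u

[]≡sub : ∀ s u t → t [ s ∖ u ] ≡ sub (single s u) t
[]≡sub s u t = subst≡sub s 0 u t

ren-single : ∀ ρ s u → ρ ʳ∘ˢ single s u ≐ single s (ren ρ u) ˢ∘ʳ liftRen s ρ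
ren-single ρ ⋆ u ⋆ zero    = refl
ren-single ρ ⋆ u ⋆ (suc n) = refl
ren-single ρ ◇ u ◇ zero    = refl
ren-single ρ ◇ u ◇ (suc n) = refl
ren-single ρ ⋆ u ◇ n       = refl
ren-single ρ ◇ u ⋆ n       = refl

ren-[] : ∀ ρ s t u → ren ρ (t [ s ∖ u ]) ≡ ren (liftRen s ρ) t [ s ∖ ren ρ u ]
ren-[] ρ s t u = begin
  ren ρ (t [ s ∖ u ])                         ≡⟨ cong (ren ρ) ([]≡sub s u t) ⟩
  ren ρ (sub (single s u) t)                  ≡⟨ ren-sub ρ _ t ⟩
  sub (ρ ʳ∘ˢ single s u) t                    ≡⟨ sub-cong (ren-single ρ s u) t ⟩
  sub (single s (ren ρ u) ˢ∘ʳ liftRen s ρ) t  ≡⟨ sub-ren _ _ t ⟨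
  sub (single s (ren ρ u)) (ren (liftRen s ρ) t)
    ≡⟨ []≡sub s (ren ρ u) (ren (liftRen s ρ) t) ⟨
  ren (liftRen s ρ) t [ s ∖ ren ρ u ]         ∎
  where open ≡-Reasoning

single-up : ∀ s v → single s v ˢ∘ʳ up s ≐ idSub
single-up ⋆ v ⋆ n = refl
single-up ⋆ v ◇ n = refl
single-up ◇ v ⋆ n = refl
single-up ◇ v ◇ n = refl

single-weaken : ∀ s v x → sub (single s v) (ren (up s) x) ≡ x
single-weaken s v x = trans (sub-ren _ _ x) (trans (sub-cong (single-up s v) x) (sub-id x))

sub-single : ∀ σ s u → σ ∘ˢ single s u ≐ single s (sub σ u) ∘ˢ liftSub s σ
sub-single σ ⋆ u ⋆ zero    = refl
sub-single σ ⋆ u ⋆ (suc n) = sym (single-weaken ⋆ (sub σ u) (σ ⋆ n))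
sub-single σ ⋆ u ◇ n       = sym (single-weaken ⋆ (sub σ u) (σ ◇ n))
sub-single σ ◇ u ⋆ n       = sym (single-weaken ◇ (sub σ u) (σ ⋆ n))
sub-single σ ◇ u ◇ zero    = refl
sub-single σ ◇ u ◇ (suc n) = sym (single-weaken ◇ (sub σ u) (σ ◇ n))

sub-[] : ∀ σ s t u → sub σ (t [ s ∖ u ]) ≡ sub (liftSub s σ) t [ s ∖ sub σ u ]
sub-[] σ s t u = begin
  sub σ (t [ s ∖ u ])                          ≡⟨ cong (sub σ) ([]≡sub s u t) ⟩
  sub σ (sub (single s u) t)                   ≡⟨ sub-sub σ _ t ⟩
  sub (σ ∘ˢ single s u) t                      ≡⟨ sub-cong (sub-single σ s u) t ⟩
  sub (single s (sub σ u) ∘ˢ liftSub s σ) t    ≡⟨ sub-sub _ _ t ⟨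
  sub (single s (sub σ u)) (sub (liftSub s σ) t)
    ≡⟨ []≡sub s (sub σ u) (sub (liftSub s σ) t) ⟨
  sub (liftSub s σ) t [ s ∖ sub σ u ]          ∎
  where open ≡-Reasoning

⋆? : Tag → Bool
⋆? ⋆ = true
⋆? ◇ = false

bool-clash : ∀ {A : Set} {x} → x ≡ true → x ≡ false → A
bool-clash refl ()

-- ε? t decides t ▷ε* ε (see ▷ε*-ε?, ε?-sound): a term extracts to ε
-- iff its head, looking through λ-bodies and applied functions, is a
-- ⋆-variable, a ⋆-projection or ε itself.  So s(u) = s iff ε? u ≡ ⋆? s.
ε? : Term → Bool
ε? (sort _) = false
ε? (var s _) = ⋆? s
ε? (lam _ _ t) = ε? t
ε? (app t _) = ε? t
ε? (pi _ _ _) = false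
ε? (sig _ _ _ _) = false
ε? (pair _ _ _ _ _ _) = false
ε? (π₁ _) = false
ε? (π₂ s _) = ⋆? s
ε? ε = true

ε?-ren : ∀ ρ t → ε? (ren ρ t) ≡ ε? t
ε?-ren ρ (sort k) = refl
ε?-ren ρ (var s n) = refl
ε?-ren ρ (lam b A t) = ε?-ren _ t
ε?-ren ρ (app t u) = ε?-ren ρ t
ε?-ren ρ (pi b A B) = refl
ε?-ren ρ (sig s' b A B) = refl
ε?-ren ρ (pair s' b A B a c) = refl
ε?-ren ρ (π₁ t) = refl
ε?-ren ρ (π₂ s t) = refl
ε?-ren ρ ε = refl

TagRespecting : Sub → Set
TagRespecting σ = ∀ s n → ε? (σ s n) ≡ ⋆? s

liftSub-respecting : ∀ {σ} → TagRespecting σ → ∀ b → TagRespecting (liftSub b σ)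
liftSub-respecting {σ} h b s n with sameTag b s
liftSub-respecting {σ} h b s zero    | true = refl
liftSub-respecting {σ} h b s (suc n) | true = trans (ε?-ren (up b) (σ s n)) (h s n)
... | false = trans (ε?-ren (up b) (σ s n)) (h s n)

ε?-sub : ∀ {σ} → TagRespecting σ → ∀ t → ε? (sub σ t) ≡ ε? t
ε?-sub h (sort k) = refl
ε?-sub h (var s n) = h s n
ε?-sub h (lam b A t) = ε?-sub (liftSub-respecting h b) t
ε?-sub h (app t u) = ε?-sub h t
ε?-sub h (pi b A B) = refl
ε?-sub h (sig s' b A B) = refl
ε?-sub h (pair s' b A B a c) = refl
ε?-sub h (π₁ t) = refl
ε?-sub h (π₂ s t) = refl
ε?-sub h ε = refl

single-respecting : ∀ s u → ε? u ≡ ⋆? s → TagRespecting (single s u)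
single-respecting ⋆ u tag ⋆ zero    = tag
single-respecting ⋆ u tag ⋆ (suc n) = refl
single-respecting ⋆ u tag ◇ n       = refl
single-respecting ◇ u tag ⋆ n       = refl
single-respecting ◇ u tag ◇ zero    = tag
single-respecting ◇ u tag ◇ (suc n) = refl

ε?-[] : ∀ s t u → ε? u ≡ ⋆? s → ε? (t [ s ∖ u ]) ≡ ε? t
ε?-[] s t u tag = trans (cong ε? ([]≡sub s u t)) (ε?-sub (single-respecting s u tag) t)

infix 4 _⇒_
data _⇒_ : Term → Term → Set where
  ⇒ε    : ∀ {t} → ε? t ≡ true → t ⇒ ε
  ⇒sort : ∀ {k} → sort k ⇒ sort k
  ⇒var  : ∀ {s n} → var s n ⇒ var s n
  ⇒eps  : ε ⇒ ε
  ⇒lam  : ∀ {s A A' t t'} → A ⇒ A' → t ⇒ t' → lam s A t ⇒ lam s A' t'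
  ⇒app  : ∀ {t t' u u'} → t ⇒ t' → u ⇒ u' → app t u ⇒ app t' u'
  ⇒pi   : ∀ {s A A' B B'} → A ⇒ A' → B ⇒ B' → pi s A B ⇒ pi s A' B'
  ⇒sig  : ∀ {s' s A A' B B'} → A ⇒ A' → B ⇒ B' → sig s' s A B ⇒ sig s' s A' B'
  ⇒pair : ∀ {s' s A A' B B' a a' b b'} → A ⇒ A' → B ⇒ B' → a ⇒ a' → b ⇒ b' →
          pair s' s A B a b ⇒ pair s' s A' B' a' b'
  ⇒π₁   : ∀ {t t'} → t ⇒ t' → π₁ t ⇒ π₁ t'
  ⇒π₂   : ∀ {s t t'} → t ⇒ t' → π₂ s t ⇒ π₂ s t'
  ⇒β    : ∀ {s A t t' u u'} → t ⇒ t' → u ⇒ u' → ε? u ≡ ⋆? s →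
          app (lam s A t) u ⇒ t' [ s ∖ u' ]
  ⇒β₁   : ∀ {s' s A B a a' b} → a ⇒ a' → ε? a ≡ false →
          π₁ (pair s' s A B a b) ⇒ a'
  ⇒β₂   : ∀ {s'' s' s A B a b b'} → b ⇒ b' → ε? b ≡ ⋆? s'' →
          π₂ s'' (pair s' s A B a b) ⇒ b'

⇒-refl : ∀ t → t ⇒ t
⇒-refl (sort k) = ⇒sort
⇒-refl (var s n) = ⇒var
⇒-refl (lam b A t) = ⇒lam (⇒-refl A) (⇒-refl t)
⇒-refl (app t u) = ⇒app (⇒-refl t) (⇒-refl u)
⇒-refl (pi b A B) = ⇒pi (⇒-refl A) (⇒-refl B)
⇒-refl (sig s' b A B) = ⇒sig (⇒-refl A) (⇒-refl B)
⇒-refl (pair s' b A B a c) = ⇒pair (⇒-refl A) (⇒-refl B) (⇒-refl a) (⇒-refl c)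
⇒-refl (π₁ t) = ⇒π₁ (⇒-refl t)
⇒-refl (π₂ s t) = ⇒π₂ (⇒-refl t)
⇒-refl ε = ⇒eps

⇒-ε? : ∀ {t t'} → t ⇒ t' → ε? t ≡ ε? t'
⇒-ε? (⇒ε e) = e
⇒-ε? ⇒sort = refl
⇒-ε? ⇒var = refl
⇒-ε? ⇒eps = refl
⇒-ε? (⇒lam dA dt) = ⇒-ε? dt
⇒-ε? (⇒app dt du) = ⇒-ε? dt
⇒-ε? (⇒pi _ _) = refl
⇒-ε? (⇒sig _ _) = refl
⇒-ε? (⇒pair _ _ _ _) = refl
⇒-ε? (⇒π₁ _) = refl
⇒-ε? (⇒π₂ _) = refl
⇒-ε? (⇒β {s} {t' = t'} {u' = u'} dt du tag) =
  trans (⇒-ε? dt) (sym (ε?-[] s t' u' (trans (sym (⇒-ε? du)) tag)))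
⇒-ε? (⇒β₁ da tag) = trans (sym tag) (⇒-ε? da)
⇒-ε? (⇒β₂ db tag) = trans (sym tag) (⇒-ε? db)

⇒-ren : ∀ ρ {t t'} → t ⇒ t' → ren ρ t ⇒ ren ρ t'
⇒-ren ρ (⇒ε {t} e) = ⇒ε (trans (ε?-ren ρ t) e)
⇒-ren ρ ⇒sort = ⇒sort
⇒-ren ρ ⇒var = ⇒var
⇒-ren ρ ⇒eps = ⇒eps
⇒-ren ρ (⇒lam dA dt) = ⇒lam (⇒-ren ρ dA) (⇒-ren _ dt)
⇒-ren ρ (⇒app dt du) = ⇒app (⇒-ren ρ dt) (⇒-ren ρ du)
⇒-ren ρ (⇒pi dA dB) = ⇒pi (⇒-ren ρ dA) (⇒-ren _ dB)
⇒-ren ρ (⇒sig dA dB) = ⇒sig (⇒-ren ρ dA) (⇒-ren _ dB)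
⇒-ren ρ (⇒pair dA dB da db) =
  ⇒pair (⇒-ren ρ dA) (⇒-ren _ dB) (⇒-ren ρ da) (⇒-ren ρ db)
⇒-ren ρ (⇒π₁ d) = ⇒π₁ (⇒-ren ρ d)
⇒-ren ρ (⇒π₂ d) = ⇒π₂ (⇒-ren ρ d)
⇒-ren ρ (⇒β {s} {A} {t} {t'} {u} {u'} dt du tag) =
  Eq.subst (ren ρ (app (lam s A t) u) ⇒_) (sym (ren-[] ρ s t' u'))
    (⇒β (⇒-ren _ dt) (⇒-ren ρ du) (trans (ε?-ren ρ u) tag))
⇒-ren ρ (⇒β₁ {a = a} da tag) = ⇒β₁ (⇒-ren ρ da) (trans (ε?-ren ρ a) tag)
⇒-ren ρ (⇒β₂ {b = b} db tag) = ⇒β₂ (⇒-ren ρ db) (trans (ε?-ren ρ b) tag)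

_⇒ˢ_ : Sub → Sub → Set
σ ⇒ˢ σ' = ∀ s n → σ s n ⇒ σ' s n

liftSub-⇒ : ∀ {σ σ'} → σ ⇒ˢ σ' → ∀ b → liftSub b σ ⇒ˢ liftSub b σ'
liftSub-⇒ h b s n with sameTag b s
liftSub-⇒ h b s zero    | true = ⇒var
liftSub-⇒ h b s (suc n) | true = ⇒-ren (up b) (h s n)
... | false = ⇒-ren (up b) (h s n)

⇒-sub : ∀ {σ σ' t t'} → t ⇒ t' → σ ⇒ˢ σ' → TagRespecting σ →
        sub σ t ⇒ sub σ' t'
⇒-sub (⇒ε {t} e) h r = ⇒ε (trans (ε?-sub r t) e)
⇒-sub ⇒sort h r = ⇒sort
⇒-sub (⇒var {s} {n}) h r = h s n
⇒-sub ⇒eps h r = ⇒eps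
⇒-sub (⇒lam {s} dA dt) h r =
  ⇒lam (⇒-sub dA h r) (⇒-sub dt (liftSub-⇒ h s) (liftSub-respecting r s))
⇒-sub (⇒app dt du) h r = ⇒app (⇒-sub dt h r) (⇒-sub du h r)
⇒-sub (⇒pi {s} dA dB) h r =
  ⇒pi (⇒-sub dA h r) (⇒-sub dB (liftSub-⇒ h s) (liftSub-respecting r s))
⇒-sub (⇒sig {s = s} dA dB) h r =
  ⇒sig (⇒-sub dA h r) (⇒-sub dB (liftSub-⇒ h s) (liftSub-respecting r s))
⇒-sub (⇒pair {s = s} dA dB da db) h r =
  ⇒pair (⇒-sub dA h r) (⇒-sub dB (liftSub-⇒ h s) (liftSub-respecting r s))
        (⇒-sub da h r) (⇒-sub db h r)
⇒-sub (⇒π₁ d) h r = ⇒π₁ (⇒-sub d h r)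
⇒-sub (⇒π₂ d) h r = ⇒π₂ (⇒-sub d h r)
⇒-sub {σ} {σ'} (⇒β {s} {A} {t} {t'} {u} {u'} dt du tag) h r =
  Eq.subst (sub σ (app (lam s A t) u) ⇒_) (sym (sub-[] σ' s t' u'))
    (⇒β (⇒-sub dt (liftSub-⇒ h s) (liftSub-respecting r s)) (⇒-sub du h r)
        (trans (ε?-sub r u) tag))
⇒-sub (⇒β₁ {a = a} da tag) h r = ⇒β₁ (⇒-sub da h r) (trans (ε?-sub r a) tag)
⇒-sub (⇒β₂ {b = b} db tag) h r = ⇒β₂ (⇒-sub db h r) (trans (ε?-sub r b) tag)

single-⇒ : ∀ s {u u'} → u ⇒ u' → single s u ⇒ˢ single s u'
single-⇒ ⋆ d ⋆ zero    = d
single-⇒ ⋆ d ⋆ (suc n) = ⇒var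
single-⇒ ⋆ d ◇ n       = ⇒var
single-⇒ ◇ d ⋆ n       = ⇒var
single-⇒ ◇ d ◇ zero    = d
single-⇒ ◇ d ◇ (suc n) = ⇒var

⇒-[] : ∀ {s t t' u u'} → t ⇒ t' → u ⇒ u' → ε? u ≡ ⋆? s →
       t [ s ∖ u ] ⇒ t' [ s ∖ u' ]
⇒-[] {s} {t} {t'} {u} {u'} dt du tag =
  subst₂ _⇒_ (sym ([]≡sub s u t)) (sym ([]≡sub s u' t'))
    (⇒-sub dt (single-⇒ s du) (single-respecting s u tag))

-- Takahashi's complete development: contract every redex of t and collapse
-- every subterm that extracts to ε.  The helpers handle the three
-- destructors, whose redexes depend on the head of their argument.
dev : Term → Term
devApp : Term → Term → Term
devπ₁ : Term → Term
devπ₂ : Term → Term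

dev (sort k) = sort k
dev (var ⋆ n) = ε
dev (var ◇ n) = var ◇ n
dev (lam s A t) = if ε? t then ε else lam s (dev A) (dev t)
dev (app t u) = if ε? t then ε else devApp t u
dev (pi s A B) = pi s (dev A) (dev B)
dev (sig s' s A B) = sig s' s (dev A) (dev B)
dev (pair s' s A B a b) = pair s' s (dev A) (dev B) (dev a) (dev b)
dev (π₁ t) = devπ₁ t
dev (π₂ ⋆ t) = ε
dev (π₂ ◇ t) = devπ₂ t
dev ε = ε

devApp (lam s A t) u =
  if does (ε? u ≟ᵇ ⋆? s) then dev t [ s ∖ dev u ] else app (dev (lam s A t)) (dev u)
devApp t u = app (dev t) (dev u)

devπ₁ (pair s' s A B a b) = if ε? a then π₁ (dev (pair s' s A B a b)) else dev a
devπ₁ t = π₁ (dev t)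

devπ₂ (pair s' s A B a b) = if ε? b then π₂ ◇ (dev (pair s' s A B a b)) else dev b
devπ₂ t = π₂ ◇ (dev t)

dev-collapsed : ∀ t → ε? t ≡ true → dev t ≡ ε
dev-collapsed (var ⋆ n) _ = refl
dev-collapsed (lam s A t) e rewrite e = refl
dev-collapsed (app t u) e rewrite e = refl
dev-collapsed (π₂ ⋆ t) _ = refl
dev-collapsed ε _ = refl
dev-collapsed (sort k) ()
dev-collapsed (var ◇ n) ()
dev-collapsed (pi s A B) ()
dev-collapsed (sig s' s A B) ()
dev-collapsed (pair s' s A B a b) ()
dev-collapsed (π₁ t) ()
dev-collapsed (π₂ ◇ t) ()

-- a collapsing term is never a pair, so its projections develop congruently
devπ₁-collapsed : ∀ t → ε? t ≡ true → devπ₁ t ≡ π₁ ε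
devπ₁-collapsed (var s n) e = cong π₁ (dev-collapsed (var s n) e)
devπ₁-collapsed (lam s A t) e = cong π₁ (dev-collapsed (lam s A t) e)
devπ₁-collapsed (app t u) e = cong π₁ (dev-collapsed (app t u) e)
devπ₁-collapsed (π₂ s t) e = cong π₁ (dev-collapsed (π₂ s t) e)
devπ₁-collapsed ε _ = refl
devπ₁-collapsed (sort k) ()
devπ₁-collapsed (pi s A B) ()
devπ₁-collapsed (sig s' s A B) ()
devπ₁-collapsed (pair s' s A B a b) ()
devπ₁-collapsed (π₁ t) ()

devπ₂-collapsed : ∀ t → ε? t ≡ true → devπ₂ t ≡ π₂ ◇ ε
devπ₂-collapsed (var s n) e = cong (π₂ ◇) (dev-collapsed (var s n) e)
devπ₂-collapsed (lam s A t) e = cong (π₂ ◇) (dev-collapsed (lam s A t) e)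
devπ₂-collapsed (app t u) e = cong (π₂ ◇) (dev-collapsed (app t u) e)
devπ₂-collapsed (π₂ s t) e = cong (π₂ ◇) (dev-collapsed (π₂ s t) e)
devπ₂-collapsed ε _ = refl
devπ₂-collapsed (sort k) ()
devπ₂-collapsed (pi s A B) ()
devπ₂-collapsed (sig s' s A B) ()
devπ₂-collapsed (pair s' s A B a b) ()
devπ₂-collapsed (π₁ t) ()

triangle : ∀ {t t'} → t ⇒ t' → t' ⇒ dev t
triangle-app : ∀ {t t' u u'} → t ⇒ t' → u ⇒ u' → ε? t ≡ false →
               app t' u' ⇒ devApp t u
triangle-π₁ : ∀ {t t'} → t ⇒ t' → π₁ t' ⇒ devπ₁ t
triangle-π₂ : ∀ {t t'} → t ⇒ t' → π₂ ◇ t' ⇒ devπ₂ t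

triangle-β : ∀ {s A t t' u u'} → t ⇒ t' → u ⇒ u' → ε? u ≡ ⋆? s →
             t' ⇒ dev t → u' ⇒ dev u →
             t' [ s ∖ u' ] ⇒ dev (app (lam s A t) u)
triangle-β {s} {A} {t} {u = u} dt du tag △t △u with ε? t in collapses
... | true = ⇒ε (trans (sym (⇒-ε? (⇒β {A = A} dt du tag))) collapses)
... | false with ε? u ≟ᵇ ⋆? s
...   | yes _ = ⇒-[] △t △u (trans (sym (⇒-ε? du)) tag)
...   | no wrong = contradiction tag wrong

triangle-app-lam : ∀ {s A A' t t' u u'} → u ⇒ u' →
  t' ⇒ dev t → u' ⇒ dev u → lam s A' t' ⇒ dev (lam s A t) →
  app (lam s A' t') u' ⇒ devApp (lam s A t) u
triangle-app-lam {s} {u = u} du △t △u △lam with ε? u ≟ᵇ ⋆? s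
... | yes tag = ⇒β △t △u (trans (sym (⇒-ε? du)) tag)
... | no _ = ⇒app △lam △u

triangle (⇒ε {t} e) rewrite dev-collapsed t e = ⇒eps
triangle ⇒sort = ⇒sort
triangle (⇒var {⋆}) = ⇒ε refl
triangle (⇒var {◇}) = ⇒var
triangle ⇒eps = ⇒eps
triangle (⇒lam {t = t} dA dt) with ε? t in collapses
... | true = ⇒ε (trans (sym (⇒-ε? dt)) collapses)
... | false = ⇒lam (triangle dA) (triangle dt)
triangle (⇒app {t = t} dt du) with ε? t in collapses
... | true = ⇒ε (trans (sym (⇒-ε? dt)) collapses)
... | false = triangle-app dt du collapses
triangle (⇒pi dA dB) = ⇒pi (triangle dA) (triangle dB)
triangle (⇒sig dA dB) = ⇒sig (triangle dA) (triangle dB)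
triangle (⇒pair dA dB da db) = ⇒pair (triangle dA) (triangle dB) (triangle da) (triangle db)
triangle (⇒π₁ d) = triangle-π₁ d
triangle (⇒π₂ {⋆} d) = ⇒ε refl
triangle (⇒π₂ {◇} d) = triangle-π₂ d
triangle (⇒β {A = A} dt du tag) =
  triangle-β {A = A} dt du tag (triangle dt) (triangle du)
triangle (⇒β₁ da tag) rewrite tag = triangle da
triangle (⇒β₂ {⋆} db tag) = ⇒ε (trans (sym (⇒-ε? db)) tag)
triangle (⇒β₂ {◇} db tag) rewrite tag = triangle db

triangle-app (⇒ε e) du ne = bool-clash e ne
triangle-app (⇒lam {A = A} {t = t} dA dt) du _ =
  triangle-app-lam {A = A} {t = t} du
    (triangle dt) (triangle du) (triangle (⇒lam dA dt))
triangle-app d@⇒sort du _ = ⇒app (triangle d) (triangle du)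
triangle-app d@⇒var du _ = ⇒app (triangle d) (triangle du)
triangle-app d@⇒eps du _ = ⇒app (triangle d) (triangle du)
triangle-app d@(⇒app _ _) du _ = ⇒app (triangle d) (triangle du)
triangle-app d@(⇒pi _ _) du _ = ⇒app (triangle d) (triangle du)
triangle-app d@(⇒sig _ _) du _ = ⇒app (triangle d) (triangle du)
triangle-app d@(⇒pair _ _ _ _) du _ = ⇒app (triangle d) (triangle du)
triangle-app d@(⇒π₁ _) du _ = ⇒app (triangle d) (triangle du)
triangle-app d@(⇒π₂ _) du _ = ⇒app (triangle d) (triangle du)
triangle-app d@(⇒β _ _ _) du _ = ⇒app (triangle d) (triangle du)
triangle-app d@(⇒β₁ _ _) du _ = ⇒app (triangle d) (triangle du)
triangle-app d@(⇒β₂ _ _) du _ = ⇒app (triangle d) (triangle du)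

triangle-π₁ (⇒ε {t} e) rewrite devπ₁-collapsed t e = ⇒π₁ ⇒eps
triangle-π₁ (⇒pair {a = a} dA dB da db) with ε? a in collapses
... | true = ⇒π₁ (⇒pair (triangle dA) (triangle dB) (triangle da) (triangle db))
... | false = ⇒β₁ (triangle da) (trans (sym (⇒-ε? da)) collapses)
triangle-π₁ d@⇒sort = ⇒π₁ (triangle d)
triangle-π₁ d@⇒var = ⇒π₁ (triangle d)
triangle-π₁ d@⇒eps = ⇒π₁ (triangle d)
triangle-π₁ d@(⇒lam _ _) = ⇒π₁ (triangle d)
triangle-π₁ d@(⇒app _ _) = ⇒π₁ (triangle d)
triangle-π₁ d@(⇒pi _ _) = ⇒π₁ (triangle d)
triangle-π₁ d@(⇒sig _ _) = ⇒π₁ (triangle d)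
triangle-π₁ d@(⇒π₁ _) = ⇒π₁ (triangle d)
triangle-π₁ d@(⇒π₂ _) = ⇒π₁ (triangle d)
triangle-π₁ d@(⇒β _ _ _) = ⇒π₁ (triangle d)
triangle-π₁ d@(⇒β₁ _ _) = ⇒π₁ (triangle d)
triangle-π₁ d@(⇒β₂ _ _) = ⇒π₁ (triangle d)

triangle-π₂ (⇒ε {t} e) rewrite devπ₂-collapsed t e = ⇒π₂ ⇒eps
triangle-π₂ (⇒pair {b = b} dA dB da db) with ε? b in collapses
... | true = ⇒π₂ (⇒pair (triangle dA) (triangle dB) (triangle da) (triangle db))
... | false = ⇒β₂ (triangle db) (trans (sym (⇒-ε? db)) collapses)
triangle-π₂ d@⇒sort = ⇒π₂ (triangle d)
triangle-π₂ d@⇒var = ⇒π₂ (triangle d)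
triangle-π₂ d@⇒eps = ⇒π₂ (triangle d)
triangle-π₂ d@(⇒lam _ _) = ⇒π₂ (triangle d)
triangle-π₂ d@(⇒app _ _) = ⇒π₂ (triangle d)
triangle-π₂ d@(⇒pi _ _) = ⇒π₂ (triangle d)
triangle-π₂ d@(⇒sig _ _) = ⇒π₂ (triangle d)
triangle-π₂ d@(⇒π₁ _) = ⇒π₂ (triangle d)
triangle-π₂ d@(⇒π₂ _) = ⇒π₂ (triangle d)
triangle-π₂ d@(⇒β _ _ _) = ⇒π₂ (triangle d)
triangle-π₂ d@(⇒β₁ _ _) = ⇒π₂ (triangle d)
triangle-π₂ d@(⇒β₂ _ _) = ⇒π₂ (triangle d)

Ctx⊆⇒ : ∀ {R : Rel} → (∀ {a b} → R a b → a ⇒ b) →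
        ∀ {t t'} → Ctx R t t' → t ⇒ t'
Ctx⊆⇒ R⊆ (base r) = R⊆ r
Ctx⊆⇒ R⊆ (lamA c) = ⇒lam (Ctx⊆⇒ R⊆ c) (⇒-refl _)
Ctx⊆⇒ R⊆ (lamT c) = ⇒lam (⇒-refl _) (Ctx⊆⇒ R⊆ c)
Ctx⊆⇒ R⊆ (appL c) = ⇒app (Ctx⊆⇒ R⊆ c) (⇒-refl _)
Ctx⊆⇒ R⊆ (appR c) = ⇒app (⇒-refl _) (Ctx⊆⇒ R⊆ c)
Ctx⊆⇒ R⊆ (piA c) = ⇒pi (Ctx⊆⇒ R⊆ c) (⇒-refl _)
Ctx⊆⇒ R⊆ (piB c) = ⇒pi (⇒-refl _) (Ctx⊆⇒ R⊆ c)
Ctx⊆⇒ R⊆ (sigA c) = ⇒sig (Ctx⊆⇒ R⊆ c) (⇒-refl _)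
Ctx⊆⇒ R⊆ (sigB c) = ⇒sig (⇒-refl _) (Ctx⊆⇒ R⊆ c)
Ctx⊆⇒ R⊆ (pairA c) = ⇒pair (Ctx⊆⇒ R⊆ c) (⇒-refl _) (⇒-refl _) (⇒-refl _)
Ctx⊆⇒ R⊆ (pairB c) = ⇒pair (⇒-refl _) (Ctx⊆⇒ R⊆ c) (⇒-refl _) (⇒-refl _)
Ctx⊆⇒ R⊆ (paira c) = ⇒pair (⇒-refl _) (⇒-refl _) (Ctx⊆⇒ R⊆ c) (⇒-refl _)
Ctx⊆⇒ R⊆ (pairb c) = ⇒pair (⇒-refl _) (⇒-refl _) (⇒-refl _) (Ctx⊆⇒ R⊆ c)
Ctx⊆⇒ R⊆ (π₁c c) = ⇒π₁ (Ctx⊆⇒ R⊆ c)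
Ctx⊆⇒ R⊆ (π₂c c) = ⇒π₂ (Ctx⊆⇒ R⊆ c)

ε-base⊆⇒ : ∀ {a b} → ε-base a b → a ⇒ b
ε-base⊆⇒ ε-var = ⇒ε refl
ε-base⊆⇒ ε-lam = ⇒ε refl
ε-base⊆⇒ ε-app = ⇒ε refl
ε-base⊆⇒ ε-π₂ = ⇒ε refl

▷ε*-ε? : ∀ {t t'} → t ▷ε* t' → ε? t ≡ ε? t'
▷ε*-ε? [] = refl
▷ε*-ε? (r ◅ rs) = trans (⇒-ε? (Ctx⊆⇒ ε-base⊆⇒ r)) (▷ε*-ε? rs)

ε?-sound : ∀ t → ε? t ≡ true → t ▷ε* ε
ε?-sound (var ⋆ n) _ = base ε-var ◅ []
ε?-sound (lam s A t) e = gmap (lam s A) lamT (ε?-sound t e) ◅◅ (base ε-lam ◅ [])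
ε?-sound (app t u) e = gmap (λ x → app x u) appL (ε?-sound t e) ◅◅ (base ε-app ◅ [])
ε?-sound (π₂ ⋆ t) _ = base ε-π₂ ◅ []
ε?-sound ε _ = []
ε?-sound (sort k) ()
ε?-sound (var ◇ n) ()
ε?-sound (pi s A B) ()
ε?-sound (sig s' s A B) ()
ε?-sound (pair s' s A B a b) ()
ε?-sound (π₁ t) ()
ε?-sound (π₂ ◇ t) ()

tag⇒ε? : ∀ {u s} → TagOf u s → ε? u ≡ ⋆? s
tag⇒ε? (tag⋆ r) = ▷ε*-ε? r
tag⇒ε? {u} (tag◇ ¬r) with ε? u in collapses
... | true = contradiction (ε?-sound u collapses) ¬r
... | false = refl

ε?⇒tag : ∀ {u} s → ε? u ≡ ⋆? s → TagOf u s
ε?⇒tag {u} ⋆ e = tag⋆ (ε?-sound u e)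
ε?⇒tag ◇ e = tag◇ (λ r → bool-clash (▷ε*-ε? r) e)

β-base⊆⇒ : ∀ {a b} → β-base a b → a ⇒ b
β-base⊆⇒ (β-app tag) = ⇒β (⇒-refl _) (⇒-refl _) (tag⇒ε? tag)
β-base⊆⇒ (β-π₁ tag) = ⇒β₁ (⇒-refl _) (tag⇒ε? tag)
β-base⊆⇒ (β-π₂ tag) = ⇒β₂ (⇒-refl _) (tag⇒ε? tag)

▷βε⊆⇒ : ∀ {t t'} → t ▷βε t' → t ⇒ t'
▷βε⊆⇒ (byβ r) = Ctx⊆⇒ β-base⊆⇒ r
▷βε⊆⇒ (byε r) = Ctx⊆⇒ ε-base⊆⇒ r

▷βε*-cong : ∀ (f : Term → Term) → (∀ {R a b} → Ctx R a b → Ctx R (f a) (f b)) →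
            ∀ {a b} → a ▷βε* b → f a ▷βε* f b
▷βε*-cong f plug = gmap f λ { (byβ r) → byβ (plug r) ; (byε r) → byε (plug r) }

⇒⊆▷βε* : ∀ {t t'} → t ⇒ t' → t ▷βε* t'
⇒⊆▷βε* (⇒ε {t} e) = map byε (ε?-sound t e)
⇒⊆▷βε* ⇒sort = []
⇒⊆▷βε* ⇒var = []
⇒⊆▷βε* ⇒eps = []
⇒⊆▷βε* (⇒lam {s} {A} {A'} {t} dA dt) =
  ▷βε*-cong (λ x → lam s x t) lamA (⇒⊆▷βε* dA) ◅◅
  ▷βε*-cong (lam s A') lamT (⇒⊆▷βε* dt)
⇒⊆▷βε* (⇒app {t} {t'} {u} dt du) =
  ▷βε*-cong (λ x → app x u) appL (⇒⊆▷βε* dt) ◅◅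
  ▷βε*-cong (app t') appR (⇒⊆▷βε* du)
⇒⊆▷βε* (⇒pi {s} {A} {A'} {B} dA dB) =
  ▷βε*-cong (λ x → pi s x B) piA (⇒⊆▷βε* dA) ◅◅
  ▷βε*-cong (pi s A') piB (⇒⊆▷βε* dB)
⇒⊆▷βε* (⇒sig {s'} {s} {A} {A'} {B} dA dB) =
  ▷βε*-cong (λ x → sig s' s x B) sigA (⇒⊆▷βε* dA) ◅◅
  ▷βε*-cong (sig s' s A') sigB (⇒⊆▷βε* dB)
⇒⊆▷βε* (⇒pair {s'} {s} {A} {A'} {B} {B'} {a} {a'} {b} dA dB da db) =
  ▷βε*-cong (λ x → pair s' s x B a b) pairA (⇒⊆▷βε* dA) ◅◅
  ▷βε*-cong (λ x → pair s' s A' x a b) pairB (⇒⊆▷βε* dB) ◅◅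
  ▷βε*-cong (λ x → pair s' s A' B' x b) paira (⇒⊆▷βε* da) ◅◅
  ▷βε*-cong (pair s' s A' B' a') pairb (⇒⊆▷βε* db)
⇒⊆▷βε* (⇒π₁ d) = ▷βε*-cong π₁ π₁c (⇒⊆▷βε* d)
⇒⊆▷βε* (⇒π₂ {s} d) = ▷βε*-cong (π₂ s) π₂c (⇒⊆▷βε* d)
⇒⊆▷βε* (⇒β {s} {A} {t} {t'} {u} dt du tag) =
  ▷βε*-cong (λ x → app (lam s A x) u) (appL ∘ lamT) (⇒⊆▷βε* dt) ◅◅
  ▷βε*-cong (app (lam s A t')) appR (⇒⊆▷βε* du) ◅◅
  byβ (base (β-app (ε?⇒tag s (trans (sym (⇒-ε? du)) tag)))) ◅ []
⇒⊆▷βε* (⇒β₁ {s'} {s} {A} {B} {b = b} da tag) =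
  ▷βε*-cong (λ x → π₁ (pair s' s A B x b)) (π₁c ∘ paira) (⇒⊆▷βε* da) ◅◅
  byβ (base (β-π₁ (ε?⇒tag ◇ (trans (sym (⇒-ε? da)) tag)))) ◅ []
⇒⊆▷βε* (⇒β₂ {s''} {s'} {s} {A} {B} {a} db tag) =
  ▷βε*-cong (π₂ s'' ∘ pair s' s A B a) (π₂c ∘ pairb) (⇒⊆▷βε* db) ◅◅
  byβ (base (β-π₂ (ε?⇒tag s'' (trans (sym (⇒-ε? db)) tag)))) ◅ []

strip : ∀ {t a b} → t ⇒ a → Star _⇒_ t b → ∃[ c ] (Star _⇒_ a c × b ⇒ c)
strip d [] = _ , [] , d
strip d (d₁ ◅ ds) with strip (triangle d₁) ds
... | c , a⇒*c , b⇒c = c , triangle d ◅ a⇒*c , b⇒c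

⇒-confluent : Confluent _⇒_
⇒-confluent [] q = _ , q , []
⇒-confluent (d ◅ ds) q with strip d q
... | c₁ , a₁⇒*c₁ , b⇒c₁ with ⇒-confluent ds a₁⇒*c₁
...   | c , a⇒*c , c₁⇒*c = c , a⇒*c , b⇒c₁ ◅ c₁⇒*c

-- Church–Rosser: ▷βε* and ⇒* are the same relation, so ▷βε is confluent
confluence : Confluent _▷βε_
confluence p q with ⇒-confluent (map ▷βε⊆⇒ p) (map ▷βε⊆⇒ q)
... | c , a⇒*c , b⇒*c = c , ⇒*⊆▷βε* a⇒*c , ⇒*⊆▷βε* b⇒*c
  where
  ⇒*⊆▷βε* : ∀ {a b} → Star _⇒_ a b → a ▷βε* b
  ⇒*⊆▷βε* [] = []
  ⇒*⊆▷βε* (d ◅ ds) = ⇒⊆▷βε* d ◅◅ ⇒*⊆▷βε* ds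

infix 4 _↓_
_↓_ : Term → Term → Set
T ↓ U = ∃[ V ] (T ▷βε* V × U ▷βε* V)

↓-refl : ∀ {T} → T ↓ T
↓-refl = _ , [] , []

↓-sym : ∀ {T U} → T ↓ U → U ↓ T
↓-sym (V , p , q) = V , q , p

↓-reduce : ∀ {T T' U U'} → T ▷βε* T' → U ▷βε* U' → T ↓ U → T' ↓ U'
↓-reduce r r' (V , p , q) with confluence p r | confluence q r'
... | W , V↠W , T'↠W | W' , V↠W' , U'↠W' with confluence V↠W V↠W'
...   | X , W↠X , W'↠X = X , T'↠W ◅◅ W↠X , U'↠W' ◅◅ W'↠X

↓-expand : ∀ {T T' U U'} → T ▷βε* T' → U ▷βε* U' → T' ↓ U' → T ↓ U
↓-expand r r' (V , p , q) = V , r ◅◅ p , r' ◅◅ q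

↓-trans : ∀ {T U V} → T ↓ U → U ↓ V → T ↓ V
↓-trans (W , p , q) U↓V = ↓-expand p [] (↓-reduce q [] U↓V)

=βε⇒↓ : ∀ {T U} → T =βε U → T ↓ U
=βε⇒↓ [] = ↓-refl
=βε⇒↓ (fwd r ◅ rs) = ↓-expand (r ◅ []) [] (=βε⇒↓ rs)
=βε⇒↓ (bwd r ◅ rs) = ↓-reduce (r ◅ []) [] (=βε⇒↓ rs)

↓⇒=βε : ∀ {T U} → T ↓ U → T =βε U
↓⇒=βε (V , p , q) = a—↠b⇒a↔b p ◅◅ a—↠b⇒b↔a q

sort-reduct : ∀ {k X} → sort k ▷βε* X → X ≡ sort k
sort-reduct [] = refl
sort-reduct (byβ (base ()) ◅ _)
sort-reduct (byε (base ()) ◅ _)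

pi-reduct : ∀ {s A B X} → pi s A B ▷βε* X →
            ∃[ A' ] ∃[ B' ] (X ≡ pi s A' B' × A ▷βε* A' × B ▷βε* B')
pi-reduct [] = _ , _ , refl , [] , []
pi-reduct (byβ (base ()) ◅ _)
pi-reduct (byε (base ()) ◅ _)
pi-reduct (byβ (piA r) ◅ rs) with pi-reduct rs
... | A' , B' , refl , p , q = A' , B' , refl , byβ r ◅ p , q
pi-reduct (byβ (piB r) ◅ rs) with pi-reduct rs
... | A' , B' , refl , p , q = A' , B' , refl , p , byβ r ◅ q
pi-reduct (byε (piA r) ◅ rs) with pi-reduct rs
... | A' , B' , refl , p , q = A' , B' , refl , byε r ◅ p , q
pi-reduct (byε (piB r) ◅ rs) with pi-reduct rs
... | A' , B' , refl , p , q = A' , B' , refl , p , byε r ◅ q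

↓-sort : ∀ {T k} → T ↓ sort k → T ▷βε* sort k
↓-sort (V , p , q) with sort-reduct q
... | refl = p

sort-injective : ∀ {k k'} → sort k ↓ sort k' → k ≡ k'
sort-injective j with sort-reduct (↓-sort j)
... | refl = refl

sort≢pi : ∀ {k s A B} → ¬ (sort k ↓ pi s A B)
sort≢pi (V , p , q) with sort-reduct p | pi-reduct q
... | refl | _ , _ , () , _

pi-injective : ∀ {s A B s' C D} → pi s A B ↓ pi s' C D → s ≡ s' × A ↓ C × B ↓ D
pi-injective (V , p , q) with pi-reduct p | pi-reduct q
... | A' , B' , refl , pA , pB | C' , D' , refl , qC , qD =
  refl , (A' , pA , qC) , (B' , pB , qD)

pi-cong : ∀ {s A B A' B'} → A ↓ A' → B ↓ B' → pi s A B ↓ pi s A' B'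
pi-cong {s} {A} {B} {A'} {B'} (X , p , q) (Y , p' , q') =
    pi s X Y
  , ▷βε*-cong (λ x → pi s x B) piA p ◅◅ ▷βε*-cong (pi s X) piB p'
  , ▷βε*-cong (λ x → pi s x B') piA q ◅◅ ▷βε*-cong (pi s X) piB q'

sort-stable : ∀ {T T' k} → T ▷βε* sort k → T ▷βε* T' → T' ▷βε* sort k
sort-stable r r' = ↓-sort (↓-reduce r' [] (_ , r , []))

pi-stable : ∀ {T T' s A B} → T ▷βε* pi s A B → T ▷βε* T' →
            ∃[ A' ] ∃[ B' ] (T' ▷βε* pi s A' B' × A ▷βε* A' × B ▷βε* B')
pi-stable r r' with confluence r r'
... | V , p , q with pi-reduct p
...   | A' , B' , refl , pA , pB = A' , B' , q , pA , pB

infix 4 _≤ˢ_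
data _≤ˢ_ : Sort → Sort → Set where
  Prop≤Prop : Prop ≤ˢ Prop
  Type≤Type : ∀ {i j} → i ≤ j → Type i ≤ˢ Type j

≤ˢ-refl : ∀ {k} → k ≤ˢ k
≤ˢ-refl {Prop} = Prop≤Prop
≤ˢ-refl {Type i} = Type≤Type ≤-refl

≤ˢ-trans : ∀ {k k' k''} → k ≤ˢ k' → k' ≤ˢ k'' → k ≤ˢ k''
≤ˢ-trans Prop≤Prop Prop≤Prop = Prop≤Prop
≤ˢ-trans (Type≤Type p) (Type≤Type q) = Type≤Type (≤-trans p q)

≤ˢ-antisym : ∀ {k k'} → k ≤ˢ k' → k' ≤ˢ k → k ≡ k'
≤ˢ-antisym Prop≤Prop Prop≤Prop = refl
≤ˢ-antisym (Type≤Type p) (Type≤Type q) = cong Type (≤-antisym p q)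

-- It is the syntax-directed form of ≼.
infix 4 _⊑_
data _⊑_ : Term → Term → Set where
  ⊑-conv : ∀ {T U} → T ↓ U → T ⊑ U
  ⊑-sort : ∀ {T U k k'} → T ▷βε* sort k → U ▷βε* sort k' → k ≤ˢ k' → T ⊑ U
  ⊑-pi   : ∀ {T U s A A' B B'} → T ▷βε* pi s A B → U ▷βε* pi s A' B' →
           A ↓ A' → B ⊑ B' → T ⊑ U

⊑-expand : ∀ {T T' U U'} → T ▷βε* T' → U ▷βε* U' → T' ⊑ U' → T ⊑ U
⊑-expand r r' (⊑-conv j) = ⊑-conv (↓-expand r r' j)
⊑-expand r r' (⊑-sort p q k≤k') = ⊑-sort (r ◅◅ p) (r' ◅◅ q) k≤k'
⊑-expand r r' (⊑-pi p q A↓A' B⊑B') = ⊑-pi (r ◅◅ p) (r' ◅◅ q) A↓A' B⊑B'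

⊑-reduce : ∀ {T T' U U'} → T ▷βε* T' → U ▷βε* U' → T ⊑ U → T' ⊑ U'
⊑-reduce r r' (⊑-conv j) = ⊑-conv (↓-reduce r r' j)
⊑-reduce r r' (⊑-sort p q k≤k') = ⊑-sort (sort-stable p r) (sort-stable q r') k≤k'
⊑-reduce r r' (⊑-pi p q A↓A' B⊑B') with pi-stable p r | pi-stable q r'
... | A₁ , B₁ , p₁ , A↠A₁ , B↠B₁ | A₁' , B₁' , q₁ , A'↠A₁' , B'↠B₁' =
  ⊑-pi p₁ q₁ (↓-reduce A↠A₁ A'↠A₁' A↓A') (⊑-reduce B↠B₁ B'↠B₁' B⊑B')

⊑-trans-↓ : ∀ {T U U' V} → T ⊑ U → U ↓ U' → U' ⊑ V → T ⊑ V
⊑-trans-↓ (⊑-conv T↓U) U↓U' q with ↓-trans T↓U U↓U'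
... | W , T↠W , U'↠W = ⊑-expand T↠W [] (⊑-reduce U'↠W [] q)
⊑-trans-↓ p U↓U' (⊑-conv U'↓V) with ↓-trans U↓U' U'↓V
... | W , U↠W , V↠W = ⊑-expand [] V↠W (⊑-reduce [] U↠W p)
⊑-trans-↓ (⊑-sort p q k≤k') U↓U' (⊑-sort p' q' k'≤k'')
  with sort-injective (↓-reduce q p' U↓U')
... | refl = ⊑-sort p q' (≤ˢ-trans k≤k' k'≤k'')
⊑-trans-↓ (⊑-sort _ q _) U↓U' (⊑-pi p' _ _ _) =
  contradiction (↓-reduce q p' U↓U') sort≢pi
⊑-trans-↓ (⊑-pi _ q _ _) U↓U' (⊑-sort p' _ _) =
  contradiction (↓-reduce p' q (↓-sym U↓U')) sort≢pi
⊑-trans-↓ (⊑-pi p q A↓A' B⊑B') U↓U' (⊑-pi p' q' C↓C' D⊑D')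
  with pi-injective (↓-reduce q p' U↓U')
... | refl , A'↓C , B'↓D =
  ⊑-pi p q' (↓-trans A↓A' (↓-trans A'↓C C↓C')) (⊑-trans-↓ B⊑B' B'↓D D⊑D')

⊑-trans : ∀ {T U V} → T ⊑ U → U ⊑ V → T ⊑ V
⊑-trans p q = ⊑-trans-↓ p ↓-refl q

≼⇒⊑ : ∀ {T U} → T ≼ U → T ⊑ U
≼⇒⊑ (≼-trans p q) = ⊑-trans (≼⇒⊑ p) (≼⇒⊑ q)
≼⇒⊑ (≼-type i) = ⊑-sort [] [] (Type≤Type (n≤1+n i))
≼⇒⊑ (≼-conv c) = ⊑-conv (=βε⇒↓ c)
≼⇒⊑ (≼-pi p) = ⊑-pi [] [] ↓-refl (≼⇒⊑ p)

⊑-antisym-↓ : ∀ {T U U' T'} → T ⊑ U → U' ⊑ T' → T ↓ T' → U ↓ U' → T ↓ U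
⊑-antisym-↓ (⊑-conv T↓U) _ _ _ = T↓U
⊑-antisym-↓ _ (⊑-conv U'↓T') T↓T' U↓U' =
  ↓-trans T↓T' (↓-trans (↓-sym U'↓T') (↓-sym U↓U'))
⊑-antisym-↓ (⊑-sort p q k≤k') (⊑-sort p' q' l≤l') T↓T' U↓U'
  with sort-injective (↓-reduce p q' T↓T') | sort-injective (↓-reduce q p' U↓U')
... | refl | refl with ≤ˢ-antisym k≤k' l≤l'
...   | refl = _ , p , q
⊑-antisym-↓ (⊑-sort p _ _) (⊑-pi _ q' _ _) T↓T' _ =
  contradiction (↓-reduce p q' T↓T') sort≢pi
⊑-antisym-↓ (⊑-pi p _ _ _) (⊑-sort _ q' _) T↓T' _ =
  contradiction (↓-reduce q' p (↓-sym T↓T')) sort≢pi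
⊑-antisym-↓ (⊑-pi p q A↓A' B⊑B') (⊑-pi p' q' _ D'⊑D) T↓T' U↓U'
  with pi-injective (↓-reduce p q' T↓T') | pi-injective (↓-reduce q p' U↓U')
... | refl , _ , B↓D | refl , _ , B'↓D' =
  ↓-expand p q (pi-cong A↓A' (⊑-antisym-↓ B⊑B' D'⊑D B↓D B'↓D'))

⊑-antisym : ∀ {T U} → T ⊑ U → U ⊑ T → T ↓ U
⊑-antisym p q = ⊑-antisym-↓ p q ↓-refl ↓-refl

⊑-below-sort : ∀ {T k} → T ⊑ sort k → ∃[ k' ] (k' ≤ˢ k × T ▷βε* sort k')
⊑-below-sort (⊑-conv j) = _ , ≤ˢ-refl , ↓-sort j
⊑-below-sort (⊑-sort p q k'≤k) with sort-reduct q
... | refl = _ , k'≤k , p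
⊑-below-sort (⊑-pi _ q _ _) with sort-reduct q
... | ()

⊑-above-sort : ∀ {T k} → sort k ⊑ T → ∃[ k' ] (k ≤ˢ k' × T ▷βε* sort k')
⊑-above-sort (⊑-conv j) = _ , ≤ˢ-refl , ↓-sort (↓-sym j)
⊑-above-sort (⊑-sort p q k≤k') with sort-reduct p
... | refl = _ , k≤k' , q
⊑-above-sort (⊑-pi p _ _ _) with sort-reduct p
... | ()

Type-≼ : ∀ {i j} → i ≤ j → sort (Type i) ≼ sort (Type j)
Type-≼ i≤j = go (≤⇒≤′ i≤j)
  where
  go : ∀ {i j} → i ≤′ j → sort (Type i) ≼ sort (Type j)
  go ≤′-refl = ≼-conv []
  go (≤′-step p) = ≼-trans (go p) (≼-type _)

≼Prop⇒▷ : ∀ {T} → T ≼ sort Prop → T ▷βε* sort Prop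
≼Prop⇒▷ p with ⊑-below-sort (≼⇒⊑ p)
... | Prop , Prop≤Prop , r = r

Prop≼⇒▷ : ∀ {T} → sort Prop ≼ T → T ▷βε* sort Prop
Prop≼⇒▷ p with ⊑-above-sort (≼⇒⊑ p)
... | Prop , Prop≤Prop , r = r

≼Type⇒▷ : ∀ {T i} → T ≼ sort (Type i) → ∃[ j ] (j ≤ i × T ▷βε* sort (Type j))
≼Type⇒▷ p with ⊑-below-sort (≼⇒⊑ p)
... | Type j , Type≤Type j≤i , r = j , j≤i , r

Type≼⇒▷ : ∀ {T i} → sort (Type i) ≼ T → ∃[ j ] (j ≥ i × T ▷βε* sort (Type j))
Type≼⇒▷ p with ⊑-above-sort (≼⇒⊑ p)
... | Type j , Type≤Type i≤j , r = j , i≤j , r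

corollary3p5 :
    (∀ (T : Term) →
      ((T ≼ sort Prop) ⇔ (sort Prop ≼ T))
      × ((sort Prop ≼ T) ⇔ (T =βε sort Prop))
      × ((T =βε sort Prop) ⇔ (T ▷βε* sort Prop)))
    × (∀ (T : Term) (i : ℕ) →
      (T ≼ sort (Type i)) ⇔ (∃[ j ] (j ≤ i × T ▷βε* sort (Type j))))
    × (∀ (T : Term) (i : ℕ) →
      (sort (Type i) ≼ T) ⇔ (∃[ j ] (j ≥ i × T ▷βε* sort (Type j))))
    × (∀ (T U : Term) → T ≼ U → U ≼ T → U =βε T)
corollary3p5 =
    (λ T → mk⇔ (λ p → ≼-conv (a—↠b⇒b↔a (≼Prop⇒▷ p)))
               (λ p → ≼-conv (a—↠b⇒a↔b (Prop≼⇒▷ p)))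
         , mk⇔ (λ p → a—↠b⇒a↔b (Prop≼⇒▷ p)) (λ c → ≼-conv (symmetric _ c))
         , mk⇔ (λ c → ↓-sort (=βε⇒↓ c)) a—↠b⇒a↔b)
  , (λ T i → mk⇔ ≼Type⇒▷ λ (j , j≤i , r) →
       ≼-trans (≼-conv (a—↠b⇒a↔b r)) (Type-≼ j≤i))
  , (λ T i → mk⇔ Type≼⇒▷ λ (j , i≤j , r) →
       ≼-trans (Type-≼ i≤j) (≼-conv (a—↠b⇒b↔a r)))
  , (λ T U p q → ↓⇒=βε (↓-sym (⊑-antisym (≼⇒⊑ p) (≼⇒⊑ q))))
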